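{- Let $p_0=2$ and, for $i\ge 1$, let $p_i$ be the $i$-th odd prime (so $p_1=3$, $p_2=5$, $p_3=7,\dots$). For a positive integer $n$ put $Q_n=(p_0-1)(p_1-1)\cdots(p_n-1)$ and $M_n=\{p_0,p_1,\dots,p_n\}$. Then for every positive integer $n$ there exist pairwise distinct positive integers $x_1,x_2,\dots,x_{n+2}$ such that $$\varphi(x_1)=\varphi(x_2)=\dots=\varphi(x_{n+2})=Q_n,$$ every prime divisor of each $x_i$ belongs to $M_n$, and $x_{n+2}=p_0p_1\cdots p_n$.
   Context: $\varphi$ denotes Euler's totient function. -}

module Defs where

open import Data.Nat using (ℕ; zero; suc; _+_; _*_; _∸_; _!)
open import Data.Nat.Coprimality using (coprime?)
open import Data.Nat.Primality using (prime?)
open import Data.List using (List; []; _∷_; upTo; filter; length; map)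
open import Data.Nat.ListAction using (product)
open import Relation.Nullary using (yes; no)

φ : ℕ → ℕ
φ n = length (filter (λ k → coprime? k n) (map suc (upTo n)))

-- smallest prime among m+1, m+2, ..., m+fuel (returns m+fuel if none; never
-- happens below with the fuel we give, since some prime lies in (m, m!+1])
searchPrime : ℕ → ℕ → ℕ
searchPrime m zero = m
searchPrime m (suc fuel) with prime? (suc m)
... | yes _ = suc m
... | no  _ = searchPrime (suc m) fuel

nextPrime : ℕ → ℕ
nextPrime m = searchPrime m (m ! + 1)

-- p i = the i-th prime counting from p 0 = 2, so p 1 = 3, p 2 = 5, ...;
-- for i ≥ 1 this is exactly the i-th odd prime.
p : ℕ → ℕ
p zero = 2
p (suc i) = nextPrime (p i)

primesUpTo : ℕ → List ℕ
primesUpTo n = map p (upTo (suc n))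

Q : ℕ → ℕ
Q n = product (map (λ q → q ∸ 1) (primesUpTo n))

primorial : ℕ → ℕ
primorial n = product (primesUpTo n)

-- Write P = p 0 ⋯ p n (the primorial).  The n + 2 witnesses are
--   x k = P · (p k − 1) / p k     (k = 0, …, n),      x (n + 1) = P,
-- i.e. x k replaces the factor p k of P by p k − 1.  Since every prime
-- factor of p k − 1 is one of p 0, …, p (k − 1), all of which still divide
-- x k, Euler's formula gives φ(x k) = (p 0 − 1) ⋯ (p n − 1) = Q n.  The x k
-- are strictly increasing in k because (a − 1) / a increases with a.
module Submission where

open import Defs
open import Data.Nat using (ℕ; suc; _≤_; NonZero)
open import Data.Nat.Divisibility using (_∣_)
open import Data.Nat.Primality using (Prime)
open import Data.Fin using (Fin; fromℕ)
open import Data.Product using (Σ; _×_)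
open import Data.List.Membership.Propositional using (_∈_)
open import Relation.Binary.PropositionalEquality using (_≡_; _≢_)

open import Data.Bool using (Bool; true; false; _∧_; not; if_then_else_)
open import Data.Bool.Properties using (∧-zeroʳ; ∧-identityʳ)
open import Data.Fin using (toℕ)
open import Data.Fin.Properties using (toℕ<n; toℕ-injective; toℕ-fromℕ)
open import Data.List using (applyUpTo; upTo; filter; length; _∷ʳ_; []; _∷_)
open import Data.List.Relation.Unary.All using (_∷_)
open import Data.List.Properties using (map-upTo; map-∘; applyUpTo-∷ʳ)
open import Data.List.Membership.Propositional.Properties using (∈-map⁺; ∈-upTo⁺)
open import Data.Nat
  using (zero; _+_; _*_; _∸_; _<_; _!; z≤n; z<s; s≤s; s≤s⁻¹; >-nonZero; nonTrivial⇒n>1; nonTrivial⇒≢1)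
open import Data.Nat.ListAction using (product)
open import Data.Nat.ListAction.Properties using (product-++)
open import Data.Nat.Properties
open import Data.Nat.Divisibility
  using (_∣?_; ∣-refl; ∣-trans; _∣0; ∣⇒≤; ∣1⇒≡1; m∣m*n; n∣m*n; ∣m∣n⇒∣m+n; ∣m+n∣m⇒∣n; m≤n⇒m!∣n!)
open import Data.Nat.Coprimality using (Coprime; coprime?; coprime-+; coprime-divisor)
import Data.Nat.Coprimality as Coprimality
open import Data.Nat.Primality
  using (prime[2]; prime?; euclidsLemma; prime⇒irreducible; prime⇒nonTrivial; prime⇒nonZero)
open import Data.Nat.Primality.Factorisation using (factorise)
open import Data.Nat.Tactic.RingSolver using (solve-∀)
open import Data.Product using (∃; _,_; proj₁)
open import Data.Sum using (_⊎_; inj₁; inj₂)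
open import Function using (_∘_; _⇔_; mk⇔; Equivalence)
open import Level using (0ℓ)
open import Relation.Binary.Definitions using (tri<; tri≈; tri>)
open import Relation.Binary.PropositionalEquality using (refl; sym; trans; cong; cong₂; subst; module ≡-Reasoning)
open import Relation.Nullary using (¬_; does; yes; no; _×-dec_; ¬?; contradiction)
open import Relation.Nullary.Decidable using (does-⇔; dec-true; dec-false)
open import Relation.Unary using (Pred; Decidable)

primeFactor : ∀ n → n ≢ 1 → ∃ λ q → Prime q × q ∣ n
primeFactor zero          _   = 2 , prime[2] , 2 ∣0
primeFactor (suc zero)    n≢1 = contradiction refl n≢1
primeFactor n@(suc (suc _)) _ with factorise n
... | record { factors = [] ; isFactorisation = () }
... | record { factors = q ∷ _ ; isFactorisation = n≡Πqs ; factorsPrime = q-prime ∷ _ } =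
  q , q-prime , subst (q ∣_) (sym n≡Πqs) (m∣m*n _)

prime⇒≥2 : ∀ {q} → Prime q → 2 ≤ q
prime⇒≥2 {q} q-prime = nonTrivial⇒n>1 q {{prime⇒nonTrivial q-prime}}

record IsNextPrime (m q : ℕ) : Set where
  field
    isPrime : Prime q
    above   : m < q
    least   : ∀ {r} → m < r → r < q → ¬ Prime r

searchPrime-correct : ∀ m fuel → (∃ λ q → Prime q × m < q × q ≤ m + fuel) →
                      IsNextPrime m (searchPrime m fuel)
searchPrime-correct m zero (q , _ , m<q , q≤m+0) =
  contradiction (subst (q ≤_) (+-identityʳ m) q≤m+0) (<⇒≱ m<q)
searchPrime-correct m (suc fuel) (q , q-prime , m<q , q≤) with prime? (suc m)
... | yes sm-prime = record
  { isPrime = sm-prime ; above = n<1+n m ; least = λ m<r r<1+m → contradiction (s≤s⁻¹ r<1+m) (<⇒≱ m<r) }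
... | no ¬sm-prime = record
  { isPrime = isPrime ; above = <-trans (n<1+n m) above ; least = least′ }
  where
  sm<q : suc m < q
  sm<q with m≤n⇒m<n∨m≡n m<q
  ... | inj₁ sm<q = sm<q
  ... | inj₂ refl = contradiction q-prime ¬sm-prime
  open IsNextPrime (searchPrime-correct (suc m) fuel (q , q-prime , sm<q , subst (q ≤_) (+-suc m fuel) q≤))
  least′ : ∀ {r} → m < r → r < searchPrime (suc m) fuel → ¬ Prime r
  least′ m<r r<s with m≤n⇒m<n∨m≡n m<r
  ... | inj₁ sm<r = least sm<r r<s
  ... | inj₂ refl = ¬sm-prime

∣! : ∀ {q m} → 0 < q → q ≤ m → q ∣ m !
∣! {suc q} _ q≤m = ∣-trans (m∣m*n (q !)) (m≤n⇒m!∣n! q≤m)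

1<m!+1 : ∀ m → 1 < m ! + 1
1<m!+1 m = +-monoˡ-≤ 1 (1≤n! m)

-- Euclid: m ! + 1 has a prime factor, and none of its prime factors is ≤ m.
euclid : ∀ m → ∃ λ q → Prime q × m < q × q ≤ m ! + 1
euclid m with primeFactor (m ! + 1) (λ eq → <⇒≢ (1<m!+1 m) (sym eq))
... | q , q-prime , q∣m!+1 = q , q-prime , m<q , ∣⇒≤ {{>-nonZero (<-trans z<s (1<m!+1 m))}} q∣m!+1
  where
  m<q : m < q
  m<q with m <? q
  ... | yes m<q = m<q
  ... | no m≮q = contradiction (∣1⇒≡1 (∣m+n∣m⇒∣n q∣m!+1 q∣m!)) (nonTrivial⇒≢1 {{prime⇒nonTrivial q-prime}})
    where
    q∣m! : q ∣ m !
    q∣m! = ∣! (<-trans z<s (prime⇒≥2 q-prime)) (≮⇒≥ m≮q)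

nextPrime-correct : ∀ m → IsNextPrime m (nextPrime m)
nextPrime-correct m with euclid m
... | q , q-prime , m<q , q≤ = searchPrime-correct m (m ! + 1) (q , q-prime , m<q , ≤-trans q≤ (m≤n+m _ m))

p-prime : ∀ i → Prime (p i)
p-prime zero    = prime[2]
p-prime (suc i) = IsNextPrime.isPrime (nextPrime-correct (p i))

p-increasing : ∀ {i j} → i < j → p i < p j
p-increasing {i} {suc j} i<1+j with m≤n⇒m<n∨m≡n (s≤s⁻¹ i<1+j)
... | inj₁ i<j  = <-trans (p-increasing i<j) (IsNextPrime.above (nextPrime-correct (p j)))
... | inj₂ refl = IsNextPrime.above (nextPrime-correct (p i))

p-monotone : ∀ {i j} → i ≤ j → p i ≤ p j
p-monotone i≤j with m≤n⇒m<n∨m≡n i≤j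
... | inj₁ i<j  = <⇒≤ (p-increasing i<j)
... | inj₂ refl = ≤-refl

p-exhaustive : ∀ m {q} → Prime q → q < p m → ∃ λ j → j < m × q ≡ p j
p-exhaustive zero    q-prime q<2 = contradiction (prime⇒≥2 q-prime) (<⇒≱ q<2)
p-exhaustive (suc m) {q} q-prime q<pm+1 with <-cmp q (p m)
... | tri< q<pm _ _ = let (j , j<m , q≡pj) = p-exhaustive m q-prime q<pm in j , m<n⇒m<1+n j<m , q≡pj
... | tri≈ _ q≡pm _ = m , n<1+n m , q≡pm
... | tri> _ _ pm<q = contradiction q-prime (IsNextPrime.least (nextPrime-correct (p m)) pm<q q<pm+1)

⟦_⟧ : Bool → ℕ
⟦ b ⟧ = if b then 1 else 0

count : (ℕ → Bool) → ℕ → ℕ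
count h zero    = 0
count h (suc n) = ⟦ h 1 ⟧ + count (h ∘ suc) n

count-cong : ∀ {h h′} n → (∀ k → h k ≡ h′ k) → count h n ≡ count h′ n
count-cong zero    h≗h′ = refl
count-cong (suc n) h≗h′ = cong₂ _+_ (cong ⟦_⟧ (h≗h′ 1)) (count-cong n (h≗h′ ∘ suc))

count-+ : ∀ h a b → count h (a + b) ≡ count h a + count (λ k → h (a + k)) b
count-+ h zero    b = refl
count-+ h (suc a) b = trans (cong (⟦ h 1 ⟧ +_) (count-+ (h ∘ suc) a b)) (sym (+-assoc ⟦ h 1 ⟧ _ _))

count-last : ∀ h n → count h (suc n) ≡ count h n + ⟦ h (suc n) ⟧
count-last h zero    = +-comm ⟦ h 1 ⟧ 0
count-last h (suc n) = trans (cong (⟦ h 1 ⟧ +_) (count-last (h ∘ suc) n)) (sym (+-assoc ⟦ h 1 ⟧ _ _))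

count-none : ∀ h n → (∀ k → 0 < k → k ≤ n → h k ≡ false) → count h n ≡ 0
count-none h zero    _    = refl
count-none h (suc n) none rewrite none 1 z<s (s≤s z≤n) =
  count-none (h ∘ suc) n (λ k _ k≤n → none (suc k) z<s (s≤s k≤n))

count-periodic : ∀ h d t → (∀ k → h (d + k) ≡ h k) → count h (t * d) ≡ t * count h d
count-periodic h d zero    _        = refl
count-periodic h d (suc t) periodic = begin
  count h (d + t * d)                         ≡⟨ count-+ h d (t * d) ⟩
  count h d + count (λ k → h (d + k)) (t * d) ≡⟨ cong (count h d +_) (count-cong (t * d) periodic) ⟩
  count h d + count h (t * d)                 ≡⟨ cong (count h d +_) (count-periodic h d t periodic) ⟩
  count h d + t * count h d                   ∎
  where open ≡-Reasoning

count-split : ∀ h g n → count h n ≡ count (λ k → h k ∧ g k) n + count (λ k → h k ∧ not (g k)) n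
count-split h g zero = refl
count-split h g (suc n) with h 1 | g 1 | count-split (h ∘ suc) (g ∘ suc) n
... | false | _     | ih = ih
... | true  | true  | ih = cong suc ih
... | true  | false | ih = trans (cong suc ih) (sym (+-suc _ _))

count-multiples : ∀ h q t → .{{NonZero q}} → (∀ k → ¬ q ∣ k → h k ≡ false) →
                  count h (t * q) ≡ count (λ j → h (j * q)) t
count-multiples h q           zero    _       = refl
count-multiples h q@(suc q-1) (suc t) support = begin
  count h (q + t * q)                         ≡⟨ count-+ h q (t * q) ⟩
  count h q + count (λ k → h (q + k)) (t * q) ≡⟨ cong₂ _+_ first-block rest ⟩
  ⟦ h (1 * q) ⟧ + count (λ j → h (suc j * q)) t ∎
  where
  open ≡-Reasoning
  first-block : count h q ≡ ⟦ h (1 * q) ⟧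
  first-block = begin
    count h q             ≡⟨ count-last h q-1 ⟩
    count h q-1 + ⟦ h q ⟧ ≡⟨ cong (_+ ⟦ h q ⟧) (count-none h q-1 below-q) ⟩
    ⟦ h q ⟧               ≡⟨ cong (⟦_⟧ ∘ h) (sym (*-identityˡ q)) ⟩
    ⟦ h (1 * q) ⟧         ∎
    where
    below-q : ∀ k → 0 < k → k ≤ q-1 → h k ≡ false
    below-q k 0<k k≤q-1 = support k (λ q∣k → <⇒≱ (s≤s k≤q-1) (∣⇒≤ {{>-nonZero 0<k}} q∣k))
  rest : count (λ k → h (q + k)) (t * q) ≡ count (λ j → h (suc j * q)) t
  rest = count-multiples (λ k → h (q + k)) q t
           (λ k q∤k → support (q + k) (λ q∣q+k → q∤k (∣m+n∣m⇒∣n q∣q+k ∣-refl)))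

coprime-*-⇔ : ∀ {k a b} → Coprime k (a * b) ⇔ (Coprime k a × Coprime k b)
coprime-*-⇔ {a = a} {b} = mk⇔
  (λ c → (λ {_} (d∣k , d∣a) → c (d∣k , ∣-trans d∣a (m∣m*n b)))
       , (λ {_} (d∣k , d∣b) → c (d∣k , ∣-trans d∣b (n∣m*n a))))
  (λ (ca , cb) {_} (d∣k , d∣ab) →
     cb (d∣k , coprime-divisor (λ {_} (e∣d , e∣a) → ca (∣-trans e∣d d∣k , e∣a)) d∣ab))

coprime-prime-⇔ : ∀ {k q} → Prime q → Coprime k q ⇔ (¬ q ∣ k)
coprime-prime-⇔ q-prime = mk⇔
  (λ c q∣k → nonTrivial⇒≢1 {{prime⇒nonTrivial q-prime}} (c (q∣k , ∣-refl)))
  (λ q∤k {_} (d∣k , d∣q) → case-irreducible q∤k d∣k (prime⇒irreducible q-prime d∣q))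
  where
  case-irreducible : ∀ {k q d} → ¬ q ∣ k → d ∣ k → d ≡ 1 ⊎ d ≡ q → d ≡ 1
  case-irreducible _   _   (inj₁ d≡1)  = d≡1
  case-irreducible q∤k d∣k (inj₂ refl) = contradiction d∣k q∤k

coprime-shift-⇔ : ∀ {a k} → Coprime (a + k) a ⇔ Coprime k a
coprime-shift-⇔ = mk⇔ (λ c {_} (d∣k , d∣a) → c (∣m∣n⇒∣m+n d∣a d∣k , d∣a)) coprime-+

-- If every prime factor of c divides a, then every k coprime to a is
-- coprime to c (a common factor of k and c would have a prime factor in a).
coprime-radical : ∀ {k a c} → (∀ q → Prime q → q ∣ c → q ∣ a) → Coprime k a → Coprime k c
coprime-radical {k} {a} {c} radical ca {d} (d∣k , d∣c) with d ≟ 1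
... | yes d≡1 = d≡1
... | no  d≢1 with primeFactor d d≢1
...   | q , q-prime , q∣d = contradiction (ca (∣-trans q∣d d∣k , radical q q-prime (∣-trans q∣d d∣c)))
                                          (nonTrivial⇒≢1 {{prime⇒nonTrivial q-prime}})

coprimeTo : ℕ → ℕ → Bool
coprimeTo a k = does (coprime? k a)

length-filter-applyUpTo : ∀ {P : Pred ℕ 0ℓ} (P? : Decidable P) f n →
  length (filter P? (applyUpTo (f ∘ suc) n)) ≡ count (λ k → does (P? (f k))) n
length-filter-applyUpTo P? f zero = refl
length-filter-applyUpTo P? f (suc n) with does (P? (f 1))
... | true  = cong suc (length-filter-applyUpTo P? (f ∘ suc) n)
... | false = length-filter-applyUpTo P? (f ∘ suc) n

φ-count : ∀ n → φ n ≡ count (coprimeTo n) n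
φ-count n = trans (cong (length ∘ filter (λ k → coprime? k n)) (map-upTo suc n))
                  (length-filter-applyUpTo (λ k → coprime? k n) (λ k → k) n)

-- Coprimality to a is a-periodic, so it is counted t · φ a times up to t · a.
count-coprimeTo : ∀ a t → count (coprimeTo a) (t * a) ≡ t * φ a
count-coprimeTo a t = trans (count-periodic (coprimeTo a) a t periodic) (cong (t *_) (sym (φ-count a)))
  where
  periodic : ∀ k → coprimeTo a (a + k) ≡ coprimeTo a k
  periodic k = does-⇔ coprime-shift-⇔ (coprime? (a + k) a) (coprime? k a)

-- Multiplying a by c whose primes all divide a does not change which k are
-- coprime, so φ(a · c) = c · φ(a).
φ-radical : ∀ a c → (∀ q → Prime q → q ∣ c → q ∣ a) → φ (a * c) ≡ c * φ a
φ-radical a c radical = begin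
  φ (a * c)                         ≡⟨ φ-count (a * c) ⟩
  count (coprimeTo (a * c)) (a * c) ≡⟨ count-cong (a * c) same-coprimes ⟩
  count (coprimeTo a) (a * c)       ≡⟨ cong (count (coprimeTo a)) (*-comm a c) ⟩
  count (coprimeTo a) (c * a)       ≡⟨ count-coprimeTo a c ⟩
  c * φ a                           ∎
  where
  open ≡-Reasoning
  coprime-⇔ : ∀ {k} → Coprime k (a * c) ⇔ Coprime k a
  coprime-⇔ = mk⇔ (proj₁ ∘ Equivalence.to coprime-*-⇔)
                  (λ ca → Equivalence.from coprime-*-⇔ (ca , coprime-radical radical ca))
  same-coprimes : ∀ k → coprimeTo (a * c) k ≡ coprimeTo a k
  same-coprimes k = does-⇔ coprime-⇔ (coprime? k (a * c)) (coprime? k a)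

-- For q coprime to a, the multiples j · q coprime to a correspond to the j
-- coprime to a; among 1, …, a · q there are therefore φ(a) of them.
coprime-multiple-⇔ : ∀ {a q j} → Coprime q a → Coprime (j * q) a ⇔ Coprime j a
coprime-multiple-⇔ {a} {q} {j} q-coprime-a = mk⇔ to from
  where
  to : Coprime (j * q) a → Coprime j a
  to c = Coprimality.sym (proj₁ (Equivalence.to coprime-*-⇔ (Coprimality.sym c)))
  from : Coprime j a → Coprime (j * q) a
  from c = Coprimality.sym (Equivalence.from coprime-*-⇔ (Coprimality.sym c , Coprimality.sym q-coprime-a))

divisibleBy : ℕ → ℕ → Bool
divisibleBy q k = does (q ∣? k)

count-coprime-multiples : ∀ a q → .{{NonZero q}} → Coprime q a →
  count (λ k → coprimeTo a k ∧ divisibleBy q k) (a * q) ≡ φ a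
count-coprime-multiples a q q-coprime-a = begin
  count (λ k → H k ∧ divisibleBy q k) (a * q)           ≡⟨ count-multiples _ q a off-multiples ⟩
  count (λ j → H (j * q) ∧ divisibleBy q (j * q)) a     ≡⟨ count-cong a on-multiples ⟩
  count H a                                             ≡⟨ φ-count a ⟨
  φ a                                                   ∎
  where
  open ≡-Reasoning
  H : ℕ → Bool
  H = coprimeTo a
  off-multiples : ∀ k → ¬ q ∣ k → H k ∧ divisibleBy q k ≡ false
  off-multiples k q∤k = trans (cong (H k ∧_) (dec-false (q ∣? k) q∤k)) (∧-zeroʳ (H k))
  on-multiples : ∀ j → H (j * q) ∧ divisibleBy q (j * q) ≡ H j
  on-multiples j = begin
    H (j * q) ∧ divisibleBy q (j * q) ≡⟨ cong (H (j * q) ∧_) (dec-true (q ∣? j * q) (n∣m*n j)) ⟩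
    H (j * q) ∧ true                  ≡⟨ ∧-identityʳ (H (j * q)) ⟩
    H (j * q)                         ≡⟨ does-⇔ (coprime-multiple-⇔ q-coprime-a) (coprime? (j * q) a) (coprime? j a) ⟩
    H j                               ∎

coprime-*-prime-⇔ : ∀ {k a q} → Prime q → Coprime k (a * q) ⇔ (Coprime k a × ¬ q ∣ k)
coprime-*-prime-⇔ {k} {a} {q} q-prime = mk⇔ to from
  where
  to : Coprime k (a * q) → Coprime k a × ¬ q ∣ k
  to c = let (ca , cq) = Equivalence.to coprime-*-⇔ c in ca , Equivalence.to (coprime-prime-⇔ q-prime) cq
  from : Coprime k a × ¬ q ∣ k → Coprime k (a * q)
  from (ca , q∤k) = Equivalence.from coprime-*-⇔ (ca , Equivalence.from (coprime-prime-⇔ q-prime) q∤k)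

count-coprime-non-multiples : ∀ a q → Prime q →
  count (λ k → coprimeTo a k ∧ not (divisibleBy q k)) (a * q) ≡ φ (a * q)
count-coprime-non-multiples a q q-prime = begin
  count (λ k → coprimeTo a k ∧ not (divisibleBy q k)) (a * q) ≡⟨ count-cong (a * q) same-coprimes ⟩
  count (coprimeTo (a * q)) (a * q)                           ≡⟨ φ-count (a * q) ⟨
  φ (a * q)                                                   ∎
  where
  open ≡-Reasoning
  same-coprimes : ∀ k → coprimeTo a k ∧ not (divisibleBy q k) ≡ coprimeTo (a * q) k
  same-coprimes k = sym (does-⇔ (coprime-*-prime-⇔ q-prime) (coprime? k (a * q)) (coprime? k a ×-dec ¬? (q ∣? k)))

-- Multiplying a by a new prime q: the q · φ(a) numbers k ≤ a · q coprime to a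
-- split into the φ(a) multiples of q and the φ(a · q) numbers coprime to a · q.
φ-new-prime : ∀ a q → Prime q → ¬ q ∣ a → φ (a * q) ≡ (q ∸ 1) * φ a
φ-new-prime a zero      q-prime _   = contradiction (prime⇒≥2 q-prime) λ ()
φ-new-prime a q@(suc q′) q-prime q∤a = +-cancelˡ-≡ (φ a) _ _ (begin
  φ a + φ (a * q)                                ≡⟨ cong₂ _+_ (sym multiples) (sym non-multiples) ⟩
  count (λ k → H k ∧ D k) (a * q)
    + count (λ k → H k ∧ not (D k)) (a * q)     ≡⟨ count-split H D (a * q) ⟨
  count H (a * q)                                ≡⟨ cong (count H) (*-comm a q) ⟩
  count H (q * a)                                ≡⟨ count-coprimeTo a q ⟩
  φ a + q′ * φ a                                 ∎)
  where
  open ≡-Reasoning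
  H D : ℕ → Bool
  H = coprimeTo a
  D = divisibleBy q
  multiples : count (λ k → H k ∧ D k) (a * q) ≡ φ a
  multiples = count-coprime-multiples a q (Coprimality.sym (Equivalence.from (coprime-prime-⇔ q-prime) q∤a))
  non-multiples : count (λ k → H k ∧ not (D k)) (a * q) ≡ φ (a * q)
  non-multiples = count-coprime-non-multiples a q q-prime

prod : (ℕ → ℕ) → ℕ → ℕ
prod g zero    = 1
prod g (suc t) = prod g t * g t

prod-+ : ∀ g a b → prod g (a + b) ≡ prod g a * prod (λ j → g (a + j)) b
prod-+ g a zero    = trans (cong (prod g) (+-identityʳ a)) (sym (*-identityʳ (prod g a)))
prod-+ g a (suc b) = begin
  prod g (a + suc b)                                ≡⟨ cong (prod g) (+-suc a b) ⟩
  prod g (a + b) * g (a + b)                        ≡⟨ cong (_* g (a + b)) (prod-+ g a b) ⟩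
  prod g a * prod (λ j → g (a + j)) b * g (a + b)   ≡⟨ *-assoc (prod g a) _ _ ⟩
  prod g a * (prod (λ j → g (a + j)) b * g (a + b)) ∎
  where open ≡-Reasoning

prod-split : ∀ g {k n} → k ≤ n → prod g (suc n) ≡ prod g k * g k * prod (λ j → g (suc k + j)) (n ∸ k)
prod-split g {k} k≤n = trans (cong (prod g) (sym (cong suc (m+[n∸m]≡n k≤n)))) (prod-+ g (suc k) _)

∣-prod : ∀ g {j t} → j < t → g j ∣ prod g t
∣-prod g {j} {suc t} j<1+t with m≤n⇒m<n∨m≡n (s≤s⁻¹ j<1+t)
... | inj₁ j<t  = ∣-trans (∣-prod g j<t) (m∣m*n (g t))
... | inj₂ refl = n∣m*n (prod g j)

prod-nonZero : ∀ g t → (∀ j → NonZero (g j)) → NonZero (prod g t)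
prod-nonZero g zero    _       = _
prod-nonZero g (suc t) nonZero = m*n≢0 (prod g t) (g t) {{prod-nonZero g t nonZero}} {{nonZero t}}

product-applyUpTo : ∀ g t → product (applyUpTo g t) ≡ prod g t
product-applyUpTo g zero    = refl
product-applyUpTo g (suc t) = begin
  product (applyUpTo g (suc t))       ≡⟨ cong product (applyUpTo-∷ʳ g t) ⟨
  product (applyUpTo g t ∷ʳ g t)      ≡⟨ product-++ (applyUpTo g t) (g t ∷ []) ⟩
  product (applyUpTo g t) * (g t * 1) ≡⟨ cong₂ _*_ (product-applyUpTo g t) (*-identityʳ (g t)) ⟩
  prod g t * g t                      ∎
  where open ≡-Reasoning

∏p ∏p⁻ : ℕ → ℕ → ℕ
∏p  s = prod (λ j → p (s + j))
∏p⁻ s = prod (λ j → p (s + j) ∸ 1)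

primorial-∏p : ∀ n → primorial n ≡ ∏p 0 (suc n)
primorial-∏p n = trans (cong product (map-upTo p (suc n))) (product-applyUpTo p (suc n))

Q-∏p⁻ : ∀ n → Q n ≡ ∏p⁻ 0 (suc n)
Q-∏p⁻ n = trans (cong product (trans (sym (map-∘ (upTo (suc n)))) (map-upTo _ (suc n))))
                (product-applyUpTo _ (suc n))

p-positive : ∀ k → 0 < p k
p-positive k = <-trans z<s (prime⇒≥2 (p-prime k))

p-1-nonZero : ∀ k → NonZero (p k ∸ 1)
p-1-nonZero k = >-nonZero (∸-monoˡ-≤ 1 (prime⇒≥2 (p-prime k)))

p-1<p : ∀ k → p k ∸ 1 < p k
p-1<p k = ∸-monoʳ-< {o = 0} z<s (p-positive k)

-- Smooth s A: every prime factor of A is smaller than p s, i.e. lies among p 0, …, p (s − 1).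
Smooth : ℕ → ℕ → Set
Smooth s A = ∀ q → Prime q → q ∣ A → q < p s

smooth-1 : ∀ {s} → Smooth s 1
smooth-1 q q-prime q∣1 = contradiction (∣1⇒≡1 q∣1) (nonTrivial⇒≢1 {{prime⇒nonTrivial q-prime}})

smooth-* : ∀ {s A B} → Smooth s A → Smooth s B → Smooth s (A * B)
smooth-* {A = A} {B} smooth-A smooth-B q q-prime q∣AB with euclidsLemma A B q-prime q∣AB
... | inj₁ q∣A = smooth-A q q-prime q∣A
... | inj₂ q∣B = smooth-B q q-prime q∣B

smooth-mono : ∀ {s s′ A} → s ≤ s′ → Smooth s A → Smooth s′ A
smooth-mono s≤s′ smooth-A q q-prime q∣A = <-≤-trans (smooth-A q q-prime q∣A) (p-monotone s≤s′)

smooth-< : ∀ {s A} → .{{NonZero A}} → A < p s → Smooth s A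
smooth-< A<ps q _ q∣A = ≤-<-trans (∣⇒≤ q∣A) A<ps

smooth-∏p : ∀ s t → Smooth (s + t) (∏p s t)
smooth-∏p s zero    = smooth-1 {s + zero}
smooth-∏p s (suc t) = smooth-* {s + suc t} (smooth-mono s+t≤s+1+t (smooth-∏p s t))
  (smooth-< {s + suc t} {{prime⇒nonZero (p-prime (s + t))}} (p-increasing s+t<s+1+t))
  where
  s+t<s+1+t : s + t < s + suc t
  s+t<s+1+t = +-monoʳ-< s (n<1+n t)
  s+t≤s+1+t : s + t ≤ s + suc t
  s+t≤s+1+t = <⇒≤ s+t<s+1+t

smooth-∤ : ∀ {s A} → Smooth s A → ¬ p s ∣ A
smooth-∤ {s} smooth-A ps∣A = <-irrefl refl (smooth-A (p s) (p-prime s) ps∣A)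

φ-∏p : ∀ s t A → Smooth s A → φ (A * ∏p s t) ≡ φ A * ∏p⁻ s t
φ-∏p s zero    A _        = trans (cong φ (*-identityʳ A)) (sym (*-identityʳ (φ A)))
φ-∏p s (suc t) A smooth-A = begin
  φ (A * (∏p s t * p (s + t)))      ≡⟨ cong φ (*-assoc A _ _) ⟨
  φ (A * ∏p s t * p (s + t))        ≡⟨ φ-new-prime (A * ∏p s t) _ (p-prime (s + t)) (smooth-∤ {s + t} smooth) ⟩
  (p (s + t) ∸ 1) * φ (A * ∏p s t)  ≡⟨ cong ((p (s + t) ∸ 1) *_) (φ-∏p s t A smooth-A) ⟩
  (p (s + t) ∸ 1) * (φ A * ∏p⁻ s t) ≡⟨ rotate (φ A) (∏p⁻ s t) (p (s + t) ∸ 1) ⟩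
  φ A * (∏p⁻ s t * (p (s + t) ∸ 1)) ∎
  where
  open ≡-Reasoning
  smooth : Smooth (s + t) (A * ∏p s t)
  smooth = smooth-* {s + t} (smooth-mono (m≤m+n s t) smooth-A) (smooth-∏p s t)
  rotate : ∀ a b c → c * (a * b) ≡ a * (b * c)
  rotate = solve-∀

φ-∏p-from-0 : ∀ t → φ (∏p 0 t) ≡ ∏p⁻ 0 t
φ-∏p-from-0 t = begin
  φ (∏p 0 t)       ≡⟨ cong φ (*-identityˡ (∏p 0 t)) ⟨
  φ (1 * ∏p 0 t)   ≡⟨ φ-∏p 0 t 1 (smooth-1 {0}) ⟩
  1 * ∏p⁻ 0 t      ≡⟨ *-identityˡ (∏p⁻ 0 t) ⟩
  ∏p⁻ 0 t          ∎
  where open ≡-Reasoning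

φ-primorial : ∀ n → φ (primorial n) ≡ Q n
φ-primorial n = begin
  φ (primorial n)  ≡⟨ cong φ (primorial-∏p n) ⟩
  φ (∏p 0 (suc n)) ≡⟨ φ-∏p-from-0 (suc n) ⟩
  ∏p⁻ 0 (suc n)    ≡⟨ Q-∏p⁻ n ⟨
  Q n              ∎
  where open ≡-Reasoning

primorial-smooth : ∀ n → Smooth (suc n) (primorial n)
primorial-smooth n = subst (Smooth (suc n)) (sym (primorial-∏p n)) (smooth-∏p 0 (suc n))

primorial-nonZero : ∀ n → NonZero (primorial n)
primorial-nonZero n = subst NonZero (sym (primorial-∏p n))
                            (prod-nonZero _ (suc n) (λ j → prime⇒nonZero (p-prime j)))

-- The prime factors of p k − 1 are all below p k, hence among p 0, …, p (k − 1).
p-1-radical : ∀ k q → Prime q → q ∣ p k ∸ 1 → q ∣ ∏p 0 k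
p-1-radical k q q-prime q∣pk-1 with p-exhaustive k q-prime (smooth-< {k} {{p-1-nonZero k}} (p-1<p k) q q-prime q∣pk-1)
... | j , j<k , refl = ∣-prod (λ j → p (0 + j)) j<k

X : ℕ → ℕ → ℕ
X n k = ∏p 0 k * (p k ∸ 1) * ∏p (suc k) (n ∸ k)

head-smooth : ∀ k → Smooth (suc k) (∏p 0 k * (p k ∸ 1))
head-smooth k = smooth-* {suc k} (smooth-mono (n≤1+n k) (smooth-∏p 0 k))
                                 (smooth-mono (n≤1+n k) (smooth-< {k} {{p-1-nonZero k}} (p-1<p k)))

φ-head : ∀ k → φ (∏p 0 k * (p k ∸ 1)) ≡ ∏p⁻ 0 k * (p k ∸ 1)
φ-head k = begin
  φ (∏p 0 k * (p k ∸ 1)) ≡⟨ φ-radical (∏p 0 k) (p k ∸ 1) (p-1-radical k) ⟩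
  (p k ∸ 1) * φ (∏p 0 k) ≡⟨ cong ((p k ∸ 1) *_) (φ-∏p-from-0 k) ⟩
  (p k ∸ 1) * ∏p⁻ 0 k    ≡⟨ *-comm (p k ∸ 1) (∏p⁻ 0 k) ⟩
  ∏p⁻ 0 k * (p k ∸ 1)    ∎
  where open ≡-Reasoning

φ-X : ∀ {n k} → k ≤ n → φ (X n k) ≡ Q n
φ-X {n} {k} k≤n = begin
  φ (∏p 0 k * (p k ∸ 1) * ∏p (suc k) (n ∸ k))   ≡⟨ φ-∏p (suc k) (n ∸ k) _ (head-smooth k) ⟩
  φ (∏p 0 k * (p k ∸ 1)) * ∏p⁻ (suc k) (n ∸ k) ≡⟨ cong (_* ∏p⁻ (suc k) (n ∸ k)) (φ-head k) ⟩
  ∏p⁻ 0 k * (p k ∸ 1) * ∏p⁻ (suc k) (n ∸ k)    ≡⟨ prod-split (λ j → p j ∸ 1) k≤n ⟨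
  ∏p⁻ 0 (suc n)                                ≡⟨ Q-∏p⁻ n ⟨
  Q n                                          ∎
  where open ≡-Reasoning

X-smooth : ∀ {n k} → k ≤ n → Smooth (suc n) (X n k)
X-smooth {n} {k} k≤n = smooth-* {suc n} (smooth-mono (s≤s k≤n) (head-smooth k))
  (smooth-mono (≤-reflexive (cong suc (m+[n∸m]≡n k≤n))) (smooth-∏p (suc k) (n ∸ k)))

X-nonZero : ∀ n k → NonZero (X n k)
X-nonZero n k = m*n≢0 _ _ {{m*n≢0 _ _ {{∏p-nonZero 0 k}} {{p-1-nonZero k}}}} {{∏p-nonZero (suc k) (n ∸ k)}}
  where
  ∏p-nonZero : ∀ s t → NonZero (∏p s t)
  ∏p-nonZero s t = prod-nonZero _ t (λ j → prime⇒nonZero (p-prime (s + j)))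

X-scaled : ∀ {n k} → k ≤ n → X n k * p k ≡ primorial n * (p k ∸ 1)
X-scaled {n} {k} k≤n = begin
  ∏p 0 k * (p k ∸ 1) * rest * p k   ≡⟨ swap (∏p 0 k) (p k ∸ 1) rest (p k) ⟩
  ∏p 0 k * p k * rest * (p k ∸ 1)   ≡⟨ cong (_* (p k ∸ 1)) (prod-split p k≤n) ⟨
  ∏p 0 (suc n) * (p k ∸ 1)          ≡⟨ cong (_* (p k ∸ 1)) (primorial-∏p n) ⟨
  primorial n * (p k ∸ 1)           ∎
  where
  open ≡-Reasoning
  rest : ℕ
  rest = ∏p (suc k) (n ∸ k)
  swap : ∀ a b c d → a * b * c * d ≡ a * d * c * b
  swap = solve-∀

-- The numbers x with x · a = N · (a − 1), i.e. x = N (1 − 1/a), grow with a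
-- and stay below N; this orders the witnesses.
pred-cross-< : ∀ {a b} → 0 < a → a < b → (a ∸ 1) * b < (b ∸ 1) * a
pred-cross-< {suc a} {suc b} _ a<b = begin-strict
  a * suc b ≡⟨ *-suc a b ⟩
  a + a * b <⟨ +-monoˡ-< (a * b) (s≤s⁻¹ a<b) ⟩
  b + a * b ≡⟨ cong (b +_) (*-comm a b) ⟩
  b + b * a ≡⟨ *-suc b a ⟨
  b * suc a ∎
  where open ≤-Reasoning

scaled-< : ∀ {N a b x y} → .{{NonZero N}} → 0 < a → a < b →
           x * a ≡ N * (a ∸ 1) → y * b ≡ N * (b ∸ 1) → x < y
scaled-< {N} {a} {b} {x} {y} 0<a a<b x-scaled y-scaled = *-cancelʳ-< (a * b) x y (begin-strict
  x * (a * b)       ≡⟨ *-assoc x a b ⟨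
  x * a * b         ≡⟨ cong (_* b) x-scaled ⟩
  N * (a ∸ 1) * b   ≡⟨ *-assoc N (a ∸ 1) b ⟩
  N * ((a ∸ 1) * b) <⟨ *-monoʳ-< N (pred-cross-< 0<a a<b) ⟩
  N * ((b ∸ 1) * a) ≡⟨ *-assoc N (b ∸ 1) a ⟨
  N * (b ∸ 1) * a   ≡⟨ cong (_* a) y-scaled ⟨
  y * b * a         ≡⟨ *-assoc y b a ⟩
  y * (b * a)       ≡⟨ cong (y *_) (*-comm b a) ⟩
  y * (a * b)       ∎)
  where open ≤-Reasoning

scaled-<-whole : ∀ {N a x} → .{{NonZero N}} → 0 < a → x * a ≡ N * (a ∸ 1) → x < N
scaled-<-whole {N} {suc a} {x} _ x-scaled =
  *-cancelʳ-< (suc a) x N (subst (_< N * suc a) (sym x-scaled) (*-monoʳ-< N (n<1+n a)))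

witness : ℕ → ℕ → ℕ
witness n k with k ≤? n
... | yes _ = X n k
... | no  _ = primorial n

witness-low : ∀ {n k} → k ≤ n → witness n k ≡ X n k
witness-low {n} {k} k≤n with k ≤? n
... | yes _   = refl
... | no  k≰n = contradiction k≤n k≰n

witness-top : ∀ n → witness n (suc n) ≡ primorial n
witness-top n with suc n ≤? n
... | yes n<n = contradiction n<n (<-irrefl refl)
... | no  _   = refl

witness-elim : ∀ (R : ℕ → Set) {n} → (∀ {k} → k ≤ n → R (X n k)) → R (primorial n) →
               ∀ {k} → k ≤ suc n → R (witness n k)
witness-elim R {n} R-X R-top {k} k≤1+n with m≤n⇒m<n∨m≡n k≤1+n
... | inj₁ k<1+n = subst R (sym (witness-low (s≤s⁻¹ k<1+n))) (R-X (s≤s⁻¹ k<1+n))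
... | inj₂ refl  = subst R (sym (witness-top n)) R-top

witness-increasing : ∀ {n k l} → k < l → l ≤ suc n → witness n k < witness n l
witness-increasing {n} {k} {l} k<l l≤1+n with m≤n⇒m<n∨m≡n l≤1+n
... | inj₁ l<1+n rewrite witness-low (≤-trans (<⇒≤ k<l) (s≤s⁻¹ l<1+n)) | witness-low (s≤s⁻¹ l<1+n) =
  scaled-< {{primorial-nonZero n}} (p-positive k) (p-increasing k<l)
    (X-scaled (≤-trans (<⇒≤ k<l) (s≤s⁻¹ l<1+n))) (X-scaled (s≤s⁻¹ l<1+n))
... | inj₂ refl rewrite witness-low (s≤s⁻¹ k<l) | witness-top n =
  scaled-<-whole {{primorial-nonZero n}} (p-positive k) (X-scaled (s≤s⁻¹ k<l))

theorem5 : (n : ℕ) → 1 ≤ n →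
    Σ (Fin (suc (suc n)) → ℕ) λ x →
      ((i j : Fin (suc (suc n))) → i ≢ j → x i ≢ x j)
      × ((i : Fin (suc (suc n))) → NonZero (x i))
      × ((i : Fin (suc (suc n))) → φ (x i) ≡ Q n)
      × ((i : Fin (suc (suc n))) → (q : ℕ) → Prime q → q ∣ x i → q ∈ primesUpTo n)
      × (x (fromℕ (suc n)) ≡ primorial n)
theorem5 n _ = family , distinct , nonZero , totient , primeFactors , last
  where
  family : Fin (suc (suc n)) → ℕ
  family i = witness n (toℕ i)
  bound : (i : Fin (suc (suc n))) → toℕ i ≤ suc n
  bound i = s≤s⁻¹ (toℕ<n i)
  distinct : (i j : Fin (suc (suc n))) → i ≢ j → family i ≢ family j
  distinct i j i≢j with <-cmp (toℕ i) (toℕ j)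
  ... | tri< i<j _ _ = <⇒≢ (witness-increasing i<j (bound j))
  ... | tri≈ _ i≡j _ = contradiction (toℕ-injective i≡j) i≢j
  ... | tri> _ _ j<i = λ xi≡xj → <⇒≢ (witness-increasing j<i (bound i)) (sym xi≡xj)
  nonZero : (i : Fin (suc (suc n))) → NonZero (family i)
  nonZero i = witness-elim NonZero (λ {k} _ → X-nonZero n k) (primorial-nonZero n) (bound i)
  totient : (i : Fin (suc (suc n))) → φ (family i) ≡ Q n
  totient i = witness-elim (λ m → φ m ≡ Q n) φ-X (φ-primorial n) (bound i)
  smooth : (i : Fin (suc (suc n))) → Smooth (suc n) (family i)
  smooth i = witness-elim (Smooth (suc n)) X-smooth (primorial-smooth n) (bound i)
  primeFactors : (i : Fin (suc (suc n))) → (q : ℕ) → Prime q → q ∣ family i → q ∈ primesUpTo n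
  primeFactors i q q-prime q∣xi with p-exhaustive (suc n) q-prime (smooth i q q-prime q∣xi)
  ... | j , j<1+n , refl = ∈-map⁺ p (∈-upTo⁺ j<1+n)
  last : family (fromℕ (suc n)) ≡ primorial n
  last = trans (cong (witness n) (toℕ-fromℕ (suc n))) (witness-top n)
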